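{- Let $B\geq 2$ and let $a,b\geq 0$ be integers. Then $$s_B(ab)=b\cdot s_B(a)- \widehat{c}_B(\{ a \}^b),$$ where $\widehat{c}_B(\{a\}^b)$ denotes $\widehat{c}_B(a,a,\dots,a)$ with $b$ copies of $a$ (and equals $0$ when $b=0$).
   Context: For an integer $a\geq 0$, $s_B(a)$ is the sum of its base-$B$ digits ($s_B(0)=0$). For integers $a_1,\dots,a_r\ge 0$ with base-$B$ digits $a_i=\sum_{j\ge0}\alpha_{i,j}B^j$, $0\le\alpha_{i,j}<B$, let $t\ge0$ be the largest $j$ with some $\alpha_{i,j}\ne0$ ($t=0$ if all are zero), define carries $\delta_0=\lfloor(\sum_i\alpha_{i,0})/B\rfloor$, $\delta_j=\lfloor(\sum_i\alpha_{i,j}+\delta_{j-1})/B\rfloor$ for $1\le j\le t$ (the carries of the traditional base-$B$ column addition algorithm), carry sum $c_B(a_1,\dots,a_r)=\sum_{j=0}^t\delta_j$, terminal carry $\beta=\delta_t$, and $\widehat{c}_B(a_1,\dots,a_r):=\beta-s_B(\beta)+(B-1)c_B(a_1,\dots,a_r)$. -}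

module Defs where

open import Data.Nat using (ℕ; zero; suc; _+_; _*_; _∸_; _^_; NonZero)
open import Data.Nat.DivMod using (_/_; _%_)
open import Data.Nat.Properties using (_≟_; m^n≢0)
open import Data.List using (List; map; foldr)
open import Data.Nat.ListAction using (sum)
open import Data.Integer using (ℤ; +_; _-_) renaming (_*_ to _*ℤ_; _+_ to _+ℤ_)
open import Relation.Nullary using (yes; no)

Σ< : ℕ → (ℕ → ℕ) → ℕ
Σ< zero    f = 0
Σ< (suc n) f = Σ< n f + f n

module _ (B : ℕ) .{{_ : NonZero B}} where

  digit : ℕ → ℕ → ℕ
  digit a j = _/_ a (B ^ j) {{m^n≢0 B j}} % B

  -- s_B(a): sum of base-B digits; for B ≥ 2 all digits of index > a vanish
  -- (a < B^(a+1)), so summing indices 0..a gives the full digit sum.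
  s : ℕ → ℕ
  s a = Σ< (suc a) (digit a)

  topFrom : ℕ → ℕ → ℕ
  topFrom a zero = 0
  topFrom a (suc k) with digit a (suc k) ≟ 0
  ... | yes _ = topFrom a k
  ... | no  _ = suc k

  top : ℕ → ℕ
  top a = topFrom a a

  tIdx : List ℕ → ℕ
  tIdx as = foldr (λ a m → Data.Nat._⊔_ (top a) m) 0 as

  colSum : List ℕ → ℕ → ℕ
  colSum as j = sum (map (λ a → digit a j) as)

  δ : List ℕ → ℕ → ℕ
  δ as zero    = colSum as 0 / B
  δ as (suc j) = (colSum as (suc j) + δ as j) / B

  c : List ℕ → ℕ
  c as = Σ< (suc (tIdx as)) (δ as)

  β : List ℕ → ℕ
  β as = δ as (tIdx as)

  ĉ : List ℕ → ℤ
  ĉ as = ((+ β as) - (+ s (β as))) +ℤ (+ (B ∸ 1)) *ℤ (+ c as)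

{-# OPTIONS --safe #-}
module Submission where

-- Column addition of a₁,…,a_r: in column k the column sum plus the incoming
-- carry equals the k-th digit of Σ aᵢ plus B times the outgoing carry.  Summing
-- these equations over the columns 0..t, the column sums add up to Σ s_B(aᵢ),
-- the digits to all digits of Σ aᵢ below position t+1, and the incoming carries
-- telescope against c_B minus the terminal carry β.  What is left of Σ aᵢ above
-- position t is exactly β, whose digits contribute s_B(β).  This gives
--   s_B(Σ aᵢ) + (B-1) c_B + β = Σ s_B(aᵢ) + s_B(β),
-- and the corollary is the case of b copies of a.

open import Defs
open import Data.Nat using (ℕ; _*_; _≤_; NonZero)
open import Data.List using (replicate)
open import Data.Integer using (ℤ; +_; _-_)
open import Relation.Binary.PropositionalEquality using (_≡_)

open import Data.Nat using (zero; suc; _+_; _^_; _∸_; _<_; s≤s; _≤′_; ≤′-refl; ≤′-step)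
open import Data.Nat.Properties
open import Data.Nat.DivMod
open import Data.Nat.Divisibility using (divides)
open import Data.List using (List; []; _∷_; map)
open import Data.Nat.ListAction using (sum)
open import Relation.Binary.PropositionalEquality using (refl; sym; trans; cong; cong₂; module ≡-Reasoning)
open import Relation.Nullary using (yes; no)
open import Data.Nat.Tactic.RingSolver using (solve-∀)
import Data.Integer as ℤ
import Data.Integer.Properties as ℤ
import Data.Integer.Tactic.RingSolver as ℤ-Solver

Σ<-cong : ∀ n {f g : ℕ → ℕ} → (∀ k → f k ≡ g k) → Σ< n f ≡ Σ< n g
Σ<-cong zero    f≗g = refl
Σ<-cong (suc n) f≗g = cong₂ _+_ (Σ<-cong n f≗g) (f≗g n)

Σ<-distrib-+ : ∀ n (f g : ℕ → ℕ) → Σ< n (λ k → f k + g k) ≡ Σ< n f + Σ< n g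
Σ<-distrib-+ zero    f g = refl
Σ<-distrib-+ (suc n) f g =
  trans (cong (_+ (f n + g n)) (Σ<-distrib-+ n f g)) (interchange (Σ< n f) (Σ< n g) (f n) (g n))
  where
  interchange : ∀ a b c d → (a + b) + (c + d) ≡ (a + c) + (b + d)
  interchange = solve-∀

*-distribˡ-Σ< : ∀ n m (f : ℕ → ℕ) → Σ< n (λ k → m * f k) ≡ m * Σ< n f
*-distribˡ-Σ< zero    m f = sym (*-zeroʳ m)
*-distribˡ-Σ< (suc n) m f =
  trans (cong (_+ (m * f n)) (*-distribˡ-Σ< n m f)) (sym (*-distribˡ-+ m _ _))

Σ<-sucˡ : ∀ n (f : ℕ → ℕ) → Σ< (suc n) f ≡ f 0 + Σ< n (λ k → f (suc k))
Σ<-sucˡ zero    f = +-comm 0 (f 0)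
Σ<-sucˡ (suc n) f = trans (cong (_+ f (suc n)) (Σ<-sucˡ n f)) (+-assoc (f 0) _ _)

Σ<-vanishing-tail : ∀ {m n} (f : ℕ → ℕ) → (∀ j → m ≤ j → f j ≡ 0) → m ≤ n → Σ< n f ≡ Σ< m f
Σ<-vanishing-tail {m} f vanish m≤n = go (≤⇒≤′ m≤n)
  where
  go : ∀ {n} → m ≤′ n → Σ< n f ≡ Σ< m f
  go ≤′-refl            = refl
  go {suc n} (≤′-step p) = trans (cong₂ _+_ (go p) (vanish n (≤′⇒≤ p))) (+-identityʳ _)

sum-replicate : ∀ b a → sum (replicate b a) ≡ b * a
sum-replicate zero    a = refl
sum-replicate (suc b) a = cong (_+_ a) (sum-replicate b a)

sum-map-replicate : ∀ (f : ℕ → ℕ) b a → sum (map f (replicate b a)) ≡ b * f a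
sum-map-replicate f zero    a = refl
sum-map-replicate f (suc b) a = cong (_+_ (f a)) (sum-map-replicate f b a)

*-pred-+ : ∀ B .{{_ : NonZero B}} c → B * c ≡ (B ∸ 1) * c + c
*-pred-+ (suc B) c = +-comm c (B * c)

module BaseExpansion (B : ℕ) .{{_ : NonZero B}} (B≥2 : 2 ≤ B) where

  infixl 7 _/ᵖ_
  _/ᵖ_ : ℕ → ℕ → ℕ
  a /ᵖ k = _/_ a (B ^ k) {{m^n≢0 B k}}

  /ᵖ-sucʳ : ∀ a k → a /ᵖ suc k ≡ a /ᵖ k / B
  /ᵖ-sucʳ a k = begin
    a /ᵖ suc k                          ≡⟨ /-congʳ {{m^n≢0 B (suc k)}} {{B^k*B≢0}} (*-comm B (B ^ k)) ⟩
    _/_ a (B ^ k * B) {{B^k*B≢0}}       ≡⟨ sym (m/n/o≡m/[n*o] a (B ^ k) B {{m^n≢0 B k}} {{_}} {{B^k*B≢0}}) ⟩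
    a /ᵖ k / B                          ∎
    where
    open ≡-Reasoning
    B^k*B≢0 = m*n≢0 (B ^ k) B {{m^n≢0 B k}}

  /ᵖ-sucˡ : ∀ a k → a /ᵖ suc k ≡ a / B /ᵖ k
  /ᵖ-sucˡ a k = sym (m/n/o≡m/[n*o] a B (B ^ k) {{_}} {{m^n≢0 B k}} {{m^n≢0 B (suc k)}})

  /ᵖ-vanish-mono : ∀ a {m n} → a /ᵖ m ≡ 0 → m ≤ n → a /ᵖ n ≡ 0
  /ᵖ-vanish-mono a {m} a/ᵖm≡0 m≤n = go (≤⇒≤′ m≤n)
    where
    go : ∀ {n} → m ≤′ n → a /ᵖ n ≡ 0
    go ≤′-refl            = a/ᵖm≡0
    go {suc n} (≤′-step p) = trans (/ᵖ-sucʳ a n) (trans (/-congˡ (go p)) (0/n≡0 B))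

  digit-vanish : ∀ a {m} j → a /ᵖ m ≡ 0 → m ≤ j → digit B a j ≡ 0
  digit-vanish a j a/ᵖm≡0 m≤j = trans (%-congˡ (/ᵖ-vanish-mono a a/ᵖm≡0 m≤j)) (m*n%n≡0 0 B)

  n<B^[1+n] : ∀ n → n < B ^ suc n
  n<B^[1+n] zero    = m^n>0 B 1
  n<B^[1+n] (suc n) = begin-strict
    suc n           <⟨ +-mono-≤ (m^n>0 B (suc n)) (n<B^[1+n] n) ⟩
    P + P           ≡⟨ cong (_+_ P) (sym (+-identityʳ P)) ⟩
    2 * P           ≤⟨ *-monoˡ-≤ P B≥2 ⟩
    B ^ suc (suc n) ∎
    where
    open ≤-Reasoning
    P = B ^ suc n

  n/ᵖ[1+n]≡0 : ∀ n → n /ᵖ suc n ≡ 0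
  n/ᵖ[1+n]≡0 n = m<n⇒m/n≡0 {{m^n≢0 B (suc n)}} (n<B^[1+n] n)

  s≡Σ<-digit : ∀ a K → a /ᵖ K ≡ 0 → s B a ≡ Σ< K (digit B a)
  s≡Σ<-digit a K a/ᵖK≡0 = trans
    (sym (Σ<-vanishing-tail (digit B a) (λ j → digit-vanish a j (n/ᵖ[1+n]≡0 a)) (m≤n⊔m K (suc a))))
    (Σ<-vanishing-tail (digit B a) (λ j → digit-vanish a j a/ᵖK≡0) (m≤m⊔n K (suc a)))

  s-unfold : ∀ a → s B a ≡ a % B + s B (a / B)
  s-unfold a = begin
    s B a                                          ≡⟨ Σ<-sucˡ a (digit B a) ⟩
    digit B a 0 + Σ< a (λ k → digit B a (suc k))   ≡⟨ cong₂ _+_ (%-congˡ (n/1≡n a))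
                                                        (Σ<-cong a (λ k → %-congˡ (/ᵖ-sucˡ a k))) ⟩
    a % B + Σ< a (digit B (a / B))                 ≡⟨ cong (_+_ (a % B)) (sym (s≡Σ<-digit (a / B) a a/B/ᵖa≡0)) ⟩
    a % B + s B (a / B)                            ∎
    where
    open ≡-Reasoning
    a/B/ᵖa≡0 : a / B /ᵖ a ≡ 0
    a/B/ᵖa≡0 = trans (sym (/ᵖ-sucˡ a a)) (n/ᵖ[1+n]≡0 a)

  s-split : ∀ K a → s B a ≡ Σ< K (digit B a) + s B (a /ᵖ K)
  s-split zero    a = cong (s B) (sym (n/1≡n a))
  s-split (suc K) a = begin
    s B a                                                     ≡⟨ s-split K a ⟩
    Σ< K (digit B a) + s B (a /ᵖ K)                           ≡⟨ cong (_+_ (Σ< K (digit B a))) (s-unfold (a /ᵖ K)) ⟩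
    Σ< K (digit B a) + (digit B a K + s B (a /ᵖ K / B))       ≡⟨ cong (λ x → Σ< K (digit B a) + (digit B a K + s B x))
                                                                   (sym (/ᵖ-sucʳ a K)) ⟩
    Σ< K (digit B a) + (digit B a K + s B (a /ᵖ suc K))       ≡⟨ sym (+-assoc (Σ< K (digit B a)) _ _) ⟩
    Σ< (suc K) (digit B a) + s B (a /ᵖ suc K)                 ∎
    where open ≡-Reasoning

  a/ᵖ[1+top]≡0 : ∀ a → a /ᵖ suc (top B a) ≡ 0
  a/ᵖ[1+top]≡0 a = go a (n/ᵖ[1+n]≡0 a)
    where
    go : ∀ k → a /ᵖ suc k ≡ 0 → a /ᵖ suc (topFrom B a k) ≡ 0
    go zero    a/ᵖ1≡0 = a/ᵖ1≡0
    go (suc k) a/ᵖ[2+k]≡0 with digit B a (suc k) ≟ 0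
    ... | no  _       = a/ᵖ[2+k]≡0
    ... | yes digit≡0 = go k (begin
          a /ᵖ suc k                                  ≡⟨ m≡m%n+[m/n]*n (a /ᵖ suc k) B ⟩
          a /ᵖ suc k % B + a /ᵖ suc k / B * B         ≡⟨ cong₂ _+_ digit≡0
                                                          (cong (_* B) (trans (sym (/ᵖ-sucʳ a (suc k))) a/ᵖ[2+k]≡0)) ⟩
          0                                           ∎)
      where open ≡-Reasoning

  truncSum : List ℕ → ℕ → ℕ
  truncSum as k = sum (map (_/ᵖ k) as)

  truncSum-zero : ∀ as → truncSum as 0 ≡ sum as
  truncSum-zero []       = refl
  truncSum-zero (a ∷ as) = cong₂ _+_ (n/1≡n a) (truncSum-zero as)

  truncSum-suc : ∀ as k → truncSum as k ≡ colSum B as k + B * truncSum as (suc k)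
  truncSum-suc []       k = sym (*-zeroʳ B)
  truncSum-suc (a ∷ as) k = trans
    (cong₂ _+_ (trans (m≡m%n+[m/n]*n (a /ᵖ k) B) (cong (λ x → a /ᵖ k % B + x * B) (sym (/ᵖ-sucʳ a k))))
               (truncSum-suc as k))
    (regroup (a /ᵖ k % B) B (a /ᵖ suc k) (colSum B as k) (truncSum as (suc k)))
    where
    regroup : ∀ d B q c r → (d + q * B) + (c + B * r) ≡ (d + c) + B * (q + r)
    regroup = solve-∀

  truncSum-beyond-tIdx : ∀ as {m} → tIdx B as ≤ m → truncSum as (suc m) ≡ 0
  truncSum-beyond-tIdx []       _ = refl
  truncSum-beyond-tIdx (a ∷ as) t≤m = cong₂ _+_
    (/ᵖ-vanish-mono a (a/ᵖ[1+top]≡0 a) (s≤s (≤-trans (m≤m⊔n (top B a) (tIdx B as)) t≤m)))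
    (truncSum-beyond-tIdx as (≤-trans (m≤n⊔m (top B a) (tIdx B as)) t≤m))

  Σ<-colSum : ∀ as K → truncSum as K ≡ 0 → Σ< K (colSum B as) ≡ sum (map (s B) as)
  Σ<-colSum []       zero    _ = refl
  Σ<-colSum []       (suc K) _ = trans (+-identityʳ _) (Σ<-colSum [] K refl)
  Σ<-colSum (a ∷ as) K vanish = begin
    Σ< K (colSum B (a ∷ as))                  ≡⟨ Σ<-distrib-+ K (digit B a) (colSum B as) ⟩
    Σ< K (digit B a) + Σ< K (colSum B as)     ≡⟨ cong₂ _+_ (sym (s≡Σ<-digit a K (m+n≡0⇒m≡0 _ vanish)))
                                                   (Σ<-colSum as K (m+n≡0⇒n≡0 (a /ᵖ K) vanish)) ⟩
    s B a + sum (map (s B) as)                ∎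
    where open ≡-Reasoning

  carryIn : List ℕ → ℕ → ℕ
  carryIn as zero    = 0
  carryIn as (suc k) = δ B as k

  columnTotal : List ℕ → ℕ → ℕ
  columnTotal as k = colSum B as k + carryIn as k

  δ≡columnTotal/B : ∀ as k → δ B as k ≡ columnTotal as k / B
  δ≡columnTotal/B as zero    = /-congˡ (sym (+-identityʳ _))
  δ≡columnTotal/B as (suc k) = refl

  truncSum+carryIn-unfold : ∀ as k →
    truncSum as k + carryIn as k ≡ columnTotal as k + truncSum as (suc k) * B
  truncSum+carryIn-unfold as k =
    trans (cong (_+ carryIn as k) (truncSum-suc as k))
          (regroup (colSum B as k) (truncSum as (suc k)) (carryIn as k) B)
    where
    regroup : ∀ c q p B → c + B * q + p ≡ (c + p) + q * B
    regroup = solve-∀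

  sum/ᵖ≡truncSum+carryIn : ∀ as k → sum as /ᵖ k ≡ truncSum as k + carryIn as k
  sum/ᵖ≡truncSum+carryIn as zero    =
    trans (n/1≡n (sum as)) (trans (sym (truncSum-zero as)) (sym (+-identityʳ _)))
  sum/ᵖ≡truncSum+carryIn as (suc k) = begin
    sum as /ᵖ suc k                    ≡⟨ /ᵖ-sucʳ (sum as) k ⟩
    sum as /ᵖ k / B                    ≡⟨ /-congˡ (trans (sum/ᵖ≡truncSum+carryIn as k) (truncSum+carryIn-unfold as k)) ⟩
    (x + q * B) / B                    ≡⟨ +-distrib-/-∣ʳ x (divides q refl) ⟩
    x / B + q * B / B                  ≡⟨ cong₂ _+_ (sym (δ≡columnTotal/B as k)) (m*n/n≡m q B) ⟩
    δ B as k + q                       ≡⟨ +-comm (δ B as k) q ⟩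
    q + carryIn as (suc k)             ∎
    where
    open ≡-Reasoning
    x = columnTotal as k
    q = truncSum as (suc k)

  column-equation : ∀ as k → columnTotal as k ≡ digit B (sum as) k + B * δ B as k
  column-equation as k = begin
    x                    ≡⟨ m≡m%n+[m/n]*n x B ⟩
    x % B + x / B * B    ≡⟨ cong₂ _+_ (sym digit≡x%B)
                               (trans (*-comm _ B) (cong (B *_) (sym (δ≡columnTotal/B as k)))) ⟩
    digit B (sum as) k + B * δ B as k ∎
    where
    open ≡-Reasoning
    x = columnTotal as k
    digit≡x%B : digit B (sum as) k ≡ x % B
    digit≡x%B = trans (%-congˡ (trans (sum/ᵖ≡truncSum+carryIn as k) (truncSum+carryIn-unfold as k)))
                      ([m+kn]%n≡m%n x (truncSum as (suc k)) B)

  Σ<-carryIn+δ : ∀ as n → Σ< (suc n) (carryIn as) + δ B as n ≡ Σ< (suc n) (δ B as)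
  Σ<-carryIn+δ as n = cong (_+ δ B as n) (Σ<-sucˡ n (carryIn as))

  module _ (as : List ℕ) where

    private
      t = tIdx B as
      lowDigits = Σ< (suc t) (digit B (sum as))

    s-sum≡lowDigits+s-β : s B (sum as) ≡ lowDigits + s B (β B as)
    s-sum≡lowDigits+s-β = trans (s-split (suc t) (sum as)) (cong (λ x → lowDigits + s B x) sum/ᵖ[1+t]≡β)
      where
      sum/ᵖ[1+t]≡β : sum as /ᵖ suc t ≡ β B as
      sum/ᵖ[1+t]≡β = trans (sum/ᵖ≡truncSum+carryIn as (suc t))
                           (cong (_+ δ B as t) (truncSum-beyond-tIdx as ≤-refl))

    Σ<-colSum≡lowDigits+carries : Σ< (suc t) (colSum B as) ≡ lowDigits + (B ∸ 1) * c B as + β B as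
    Σ<-colSum≡lowDigits+carries = +-cancelʳ-≡ P _ _ (begin
      Σ< (suc t) (colSum B as) + P                             ≡⟨ sym (Σ<-distrib-+ (suc t) _ (carryIn as)) ⟩
      Σ< (suc t) (columnTotal as)                              ≡⟨ Σ<-cong (suc t) (column-equation as) ⟩
      Σ< (suc t) (λ k → digit B (sum as) k + B * δ B as k)     ≡⟨ Σ<-distrib-+ (suc t) _ _ ⟩
      lowDigits + Σ< (suc t) (λ k → B * δ B as k)              ≡⟨ cong (_+_ lowDigits) (*-distribˡ-Σ< (suc t) B (δ B as)) ⟩
      lowDigits + B * c B as                                   ≡⟨ cong (_+_ lowDigits) (*-pred-+ B (c B as)) ⟩
      lowDigits + ((B ∸ 1) * c B as + c B as)                  ≡⟨ cong (λ x → lowDigits + ((B ∸ 1) * c B as + x))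
                                                                    (sym (Σ<-carryIn+δ as t)) ⟩
      lowDigits + ((B ∸ 1) * c B as + (P + β B as))            ≡⟨ regroup lowDigits ((B ∸ 1) * c B as) P (β B as) ⟩
      lowDigits + (B ∸ 1) * c B as + β B as + P                ∎)
      where
      open ≡-Reasoning
      P = Σ< (suc t) (carryIn as)
      regroup : ∀ d e p b → d + (e + (p + b)) ≡ d + e + b + p
      regroup = solve-∀

    s-sum+carries≡Σs+s-β : s B (sum as) + (B ∸ 1) * c B as + β B as ≡ sum (map (s B) as) + s B (β B as)
    s-sum+carries≡Σs+s-β = begin
      s B (sum as) + (B ∸ 1) * c B as + β B as
        ≡⟨ cong (λ x → x + (B ∸ 1) * c B as + β B as) s-sum≡lowDigits+s-β ⟩
      lowDigits + s B (β B as) + (B ∸ 1) * c B as + β B as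
        ≡⟨ regroup lowDigits (s B (β B as)) ((B ∸ 1) * c B as) (β B as) ⟩
      lowDigits + (B ∸ 1) * c B as + β B as + s B (β B as)
        ≡⟨ cong (_+ s B (β B as)) (sym Σ<-colSum≡lowDigits+carries) ⟩
      Σ< (suc t) (colSum B as) + s B (β B as)
        ≡⟨ cong (_+ s B (β B as)) (Σ<-colSum as (suc t) (truncSum-beyond-tIdx as ≤-refl)) ⟩
      sum (map (s B) as) + s B (β B as) ∎
      where
      open ≡-Reasoning
      regroup : ∀ d x e b → d + x + e + b ≡ d + e + b + x
      regroup = solve-∀

solve-for-ℤ : ∀ (x m β sβ y : ℤ) → x ℤ.+ m ℤ.+ β ≡ y ℤ.+ sβ → x ≡ y - ((β - sβ) ℤ.+ m)
solve-for-ℤ x m β sβ y eq = begin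
  x                                           ≡⟨ cancel-lhs x m β sβ ⟩
  (x ℤ.+ m ℤ.+ β) - ((β - sβ) ℤ.+ m) - sβ     ≡⟨ cong (λ z → z - ((β - sβ) ℤ.+ m) - sβ) eq ⟩
  (y ℤ.+ sβ) - ((β - sβ) ℤ.+ m) - sβ          ≡⟨ cancel-rhs y m β sβ ⟩
  y - ((β - sβ) ℤ.+ m)                        ∎
  where
  open ≡-Reasoning
  cancel-lhs : ∀ (x m β sβ : ℤ) → x ≡ (x ℤ.+ m ℤ.+ β) - ((β - sβ) ℤ.+ m) - sβ
  cancel-lhs = ℤ-Solver.solve-∀
  cancel-rhs : ∀ (y m β sβ : ℤ) → (y ℤ.+ sβ) - ((β - sβ) ℤ.+ m) - sβ ≡ y - ((β - sβ) ℤ.+ m)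
  cancel-rhs = ℤ-Solver.solve-∀

ℕ-identity⇒ℤ-identity : ∀ x m n β sβ y → x + m * n + β ≡ y + sβ →
  + x ≡ + y - ((+ β - + sβ) ℤ.+ + m ℤ.* + n)
ℕ-identity⇒ℤ-identity x m n β sβ y eq =
  solve-for-ℤ (+ x) (+ m ℤ.* + n) (+ β) (+ sβ) (+ y) (trans (sym cast) (trans (cong +_ eq) (ℤ.pos-+ y sβ)))
  where
  cast : + (x + m * n + β) ≡ + x ℤ.+ + m ℤ.* + n ℤ.+ + β
  cast = trans (ℤ.pos-+ (x + m * n) β)
               (cong (ℤ._+ + β) (trans (ℤ.pos-+ x (m * n)) (cong (ℤ._+_ (+ x)) (ℤ.pos-* m n))))

corollary1p4 : (B : ℕ) .{{_ : NonZero B}} → 2 ≤ B → (a b : ℕ) →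
    (+ s B (a * b)) ≡ (+ (b * s B a)) - ĉ B (replicate b a)
corollary1p4 B B≥2 a b =
  ℕ-identity⇒ℤ-identity (s B (a * b)) (B ∸ 1) (c B as) (β B as) (s B (β B as)) (b * s B a) (begin
    s B (a * b) + (B ∸ 1) * c B as + β B as    ≡⟨ cong (λ x → s B x + (B ∸ 1) * c B as + β B as) a*b≡sum ⟩
    s B (sum as) + (B ∸ 1) * c B as + β B as   ≡⟨ s-sum+carries≡Σs+s-β as ⟩
    sum (map (s B) as) + s B (β B as)          ≡⟨ cong (_+ s B (β B as)) (sum-map-replicate (s B) b a) ⟩
    b * s B a + s B (β B as)                   ∎)
  where
  open ≡-Reasoning
  open BaseExpansion B B≥2
  as = replicate b a
  a*b≡sum : a * b ≡ sum as
  a*b≡sum = trans (*-comm a b) (sym (sum-replicate b a))
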